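{- The family $\mathcal{N}=\{N_{2k,k}:k=1,2,3,\dots\}$ of all proper subcomplete graphs forms an antichain under the homomorphic image ordering, and hence also under the strong homomorphic image ordering.
   Context: All graphs here are finite reflexive graphs (symmetric edge relation containing all loops). For $2k\le n$, $N_{n,k}$ has vertices $\{1,\dots,n\}$ and edges $\{\{i,j\}:1\le i\le j\le n\}\setminus\{\{1,2\},\{3,4\},\dots,\{2k-1,2k\}\}$; $N_{2k,k}$ are the proper subcomplete graphs. A homomorphism maps edges to edges; it is strong if every edge of the target between image vertices is the image of an edge. Homomorphic image ordering: $A\preceq B$ iff there is a surjective homomorphism $B\to A$; strong version: iff there is a surjective strong homomorphism $B\to A$. An antichain is a set of pairwise incomparable elements. -}

module Defs where

open import Data.Nat using (ℕ; zero; suc; _+_; _*_; _<_; _≤_)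
open import Data.Fin using (Fin; toℕ)
open import Data.Product using (Σ; ∃; _×_; _,_)
open import Data.Sum using (_⊎_)
open import Relation.Binary.PropositionalEquality using (_≡_)
open import Relation.Nullary using (¬_)

record Graph : Set₁ where
  field
    size : ℕ
    Adj  : Fin size → Fin size → Set

open Graph public

record IsReflexiveGraph (G : Graph) : Set where
  field
    loop : ∀ x → Adj G x x
    symm : ∀ x y → Adj G x y → Adj G y x

-- N_{n,k} with vertices 1..n represented as 0..n-1 (vertex i ↦ toℕ i + 1).
-- The missing edges {2m-1,2m} (m = 1..k) become {2m,2m+1} (m = 0..k-1).
-- {i,j} is a removed pair iff there is m < k with {i,j} = {2m, 2m+1}.
RemovedPair : (k : ℕ) {n : ℕ} → Fin n → Fin n → Set
RemovedPair k i j =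
  Σ ℕ λ m → m < k ×
    ((toℕ i ≡ 2 * m × toℕ j ≡ 2 * m + 1) ⊎ (toℕ i ≡ 2 * m + 1 × toℕ j ≡ 2 * m))

N : ℕ → ℕ → Graph
N n k = record { size = n ; Adj = λ i j → ¬ RemovedPair k i j }

Subcomplete : ℕ → Graph
Subcomplete k = N (2 * k) k

IsHom : (G H : Graph) → (Fin (size G) → Fin (size H)) → Set
IsHom G H f = ∀ x y → Adj G x y → Adj H (f x) (f y)

IsStrong : (G H : Graph) → (Fin (size G) → Fin (size H)) → Set
IsStrong G H f = ∀ x y → Adj H (f x) (f y) →
  Σ (Fin (size G)) λ x' → Σ (Fin (size G)) λ y' →
    f x' ≡ f x × f y' ≡ f y × Adj G x' y'

Surjective : {m n : ℕ} → (Fin m → Fin n) → Set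
Surjective {m} {n} f = ∀ (y : Fin n) → Σ (Fin m) λ x → f x ≡ y

_≼_ : Graph → Graph → Set
A ≼ B = Σ (Fin (size B) → Fin (size A)) λ f → IsHom B A f × Surjective f

_≼ₛ_ : Graph → Graph → Set
A ≼ₛ B = Σ (Fin (size B) → Fin (size A)) λ f →
  IsHom B A f × IsStrong B A f × Surjective f

IsAntichainFamily : (Graph → Graph → Set) → Set
IsAntichainFamily R = ∀ k l → 1 ≤ k → 1 ≤ l → ¬ k ≡ l →
  ¬ R (Subcomplete k) (Subcomplete l)

-- A surjective homomorphism N_{2l,l} → N_{2k,k} is injective: if f x = f y, let u be
-- the unique non-neighbour of f x and f z = u; then neither x z nor y z can be an edge,
-- since it would map onto the non-edge {f x, u}, so x and y are both the unique
-- non-neighbour of z. A bijection between the vertex sets forces 2l = 2k.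
module Submission where

open import Defs
open import Data.Product using (_×_; _,_; ∃; proj₁; proj₂)
open import Data.Sum using (_⊎_; inj₁; inj₂)
open import Data.Nat using (ℕ; zero; suc; _+_; _*_; _<_; _≤_)
open import Data.Nat.Properties
  using (≤-reflexive; ≤-trans; ≤-<-trans; m≤m+n; +-comm; *-suc; *-monoʳ-≤; *-cancelˡ-<; *-cancelˡ-≡)
open import Data.Fin using (Fin; toℕ; fromℕ<; _≟_)
open import Data.Fin.Properties using (toℕ-injective; toℕ-fromℕ<; toℕ<n; cantor-schröder-bernstein)
open import Function.Definitions using (Injective)
open import Relation.Binary.PropositionalEquality using (_≡_; refl; sym; trans; cong; subst₂; module ≡-Reasoning)
open import Relation.Nullary using (¬_)
open import Relation.Nullary.Decidable using (decidable-stable)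

private
  variable
    m n k : ℕ

section-injective : {f : Fin m → Fin n} (surj : Surjective f) →
                    Injective _≡_ _≡_ (λ y → proj₁ (surj y))
section-injective {f = f} surj {y} {y′} eq = begin
  y                   ≡⟨ sym (proj₂ (surj y)) ⟩
  f (proj₁ (surj y))  ≡⟨ cong f eq ⟩
  f (proj₁ (surj y′)) ≡⟨ proj₂ (surj y′) ⟩
  y′                  ∎
  where open ≡-Reasoning

EveryVertexHasNonNeighbour : Graph → Set
EveryVertexHasNonNeighbour H = ∀ t → ∃ λ u → ¬ Adj H t u

NonNeighbourUnique : Graph → Set
NonNeighbourUnique G = ∀ {x y z} → ¬ Adj G x z → ¬ Adj G y z → x ≡ y

surjectiveHom⇒injective : ∀ {G H} {f : Fin (size G) → Fin (size H)} →
  NonNeighbourUnique G → EveryVertexHasNonNeighbour H →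
  IsHom G H f → Surjective f → Injective _≡_ _≡_ f
surjectiveHom⇒injective {G} {H} {f} unique nonNeighbour hom surj {x} {y} fx≡fy =
  unique (separated x refl) (separated y (sym fx≡fy))
  where
  u = proj₁ (nonNeighbour (f x))
  z = proj₁ (surj u)

  separated : ∀ v → f v ≡ f x → ¬ Adj G v z
  separated v fv≡fx adj =
    proj₂ (nonNeighbour (f x)) (subst₂ (Adj H) fv≡fx (proj₂ (surj u)) (hom v z adj))

-- mate n is n xor 1; the removed pairs of N_{n,k} are the pairs {i, mate i} with i < 2k.
mate : ℕ → ℕ
mate zero          = 1
mate (suc zero)    = 0
mate (suc (suc n)) = suc (suc (mate n))

mate-double : ∀ m → mate (2 * m) ≡ 2 * m + 1
mate-double zero    = refl
mate-double (suc m) = begin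
  mate (2 * suc m)   ≡⟨ cong mate (*-suc 2 m) ⟩
  2 + mate (2 * m)   ≡⟨ cong (2 +_) (mate-double m) ⟩
  2 + 2 * m + 1      ≡⟨ cong (_+ 1) (sym (*-suc 2 m)) ⟩
  2 * suc m + 1      ∎
  where open ≡-Reasoning

mate-double+1 : ∀ m → mate (2 * m + 1) ≡ 2 * m
mate-double+1 zero    = refl
mate-double+1 (suc m) = begin
  mate (2 * suc m + 1) ≡⟨ cong (λ n → mate (n + 1)) (*-suc 2 m) ⟩
  2 + mate (2 * m + 1) ≡⟨ cong (2 +_) (mate-double+1 m) ⟩
  2 + 2 * m            ≡⟨ sym (*-suc 2 m) ⟩
  2 * suc m            ∎
  where open ≡-Reasoning

suc[double+1]≡double[suc] : ∀ m → suc (2 * m + 1) ≡ 2 * suc m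
suc[double+1]≡double[suc] m = trans (cong suc (+-comm (2 * m) 1)) (sym (*-suc 2 m))

even-or-odd : ∀ n → ∃ λ m → n ≡ 2 * m ⊎ n ≡ 2 * m + 1
even-or-odd zero = 0 , inj₁ refl
even-or-odd (suc n) with even-or-odd n
... | m , inj₁ refl = m , inj₂ (+-comm 1 (2 * m))
... | m , inj₂ refl = suc m , inj₁ (suc[double+1]≡double[suc] m)

double<double⇒< : 2 * m ≤ n → n < 2 * k → m < k
double<double⇒< {m} {n} {k} 2m≤n n<2k = *-cancelˡ-< 2 m k (≤-<-trans 2m≤n n<2k)

<⇒double+1<double : m < k → 2 * m + 1 < 2 * k
<⇒double+1<double {m} m<k = ≤-trans (≤-reflexive (suc[double+1]≡double[suc] m)) (*-monoʳ-≤ 2 m<k)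

removedPair⇒mate : {i j : Fin n} → RemovedPair k i j → toℕ i ≡ mate (toℕ j)
removedPair⇒mate (m , _ , inj₁ (i≡2m , j≡2m+1)) rewrite i≡2m | j≡2m+1 = sym (mate-double+1 m)
removedPair⇒mate (m , _ , inj₂ (i≡2m+1 , j≡2m)) rewrite i≡2m+1 | j≡2m = sym (mate-double m)

removedPair-unique : {x y z : Fin n} → RemovedPair k x z → RemovedPair k y z → x ≡ y
removedPair-unique rx ry = toℕ-injective (trans (removedPair⇒mate rx) (sym (removedPair⇒mate ry)))

-- Non-adjacency in N n k is only ¬ ¬ RemovedPair; decidable equality on Fin recovers x ≡ y.
N-nonNeighbourUnique : NonNeighbourUnique (N n k)
N-nonNeighbourUnique {x = x} {y} ¬¬rx ¬¬ry = decidable-stable (x ≟ y) λ x≢y →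
  ¬¬rx λ rx → ¬¬ry λ ry → x≢y (removedPair-unique rx ry)

removedPair-exists : ∀ k (t : Fin (2 * k)) → ∃ λ u → RemovedPair k t u
removedPair-exists k t with even-or-odd (toℕ t)
... | m , inj₁ t≡2m = fromℕ< 2m+1<2k , m , m<k , inj₁ (t≡2m , toℕ-fromℕ< 2m+1<2k)
  where
  m<k : m < k
  m<k = double<double⇒< (≤-reflexive (sym t≡2m)) (toℕ<n t)
  2m+1<2k : 2 * m + 1 < 2 * k
  2m+1<2k = <⇒double+1<double m<k
... | m , inj₂ t≡2m+1 = fromℕ< 2m<2k , m , m<k , inj₂ (t≡2m+1 , toℕ-fromℕ< 2m<2k)
  where
  m<k : m < k
  m<k = double<double⇒< (≤-trans (m≤m+n (2 * m) 1) (≤-reflexive (sym t≡2m+1))) (toℕ<n t)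
  2m<2k : 2 * m < 2 * k
  2m<2k = ≤-<-trans (m≤m+n (2 * m) 1) (<⇒double+1<double m<k)

subcomplete-everyVertexHasNonNeighbour : ∀ k → EveryVertexHasNonNeighbour (Subcomplete k)
subcomplete-everyVertexHasNonNeighbour k t =
  let u , r = removedPair-exists k t in u , λ ¬r → ¬r r

subcomplete-≼⇒≡ : ∀ {k l} → Subcomplete k ≼ Subcomplete l → l ≡ k
subcomplete-≼⇒≡ {k} {l} (f , hom , surj) = *-cancelˡ-≡ l k 2
  (cantor-schröder-bernstein f-injective (section-injective surj))
  where
  f-injective : Injective _≡_ _≡_ f
  f-injective = surjectiveHom⇒injective {f = f}
    N-nonNeighbourUnique (subcomplete-everyVertexHasNonNeighbour k) hom surj

≼ₛ⇒≼ : ∀ {A B} → A ≼ₛ B → A ≼ B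
≼ₛ⇒≼ (f , hom , _ , surj) = f , hom , surj

proposition3p3 : IsAntichainFamily _≼_ × IsAntichainFamily _≼ₛ_
proposition3p3 = (λ _ _ _ _ k≢l A≼B → k≢l (sym (subcomplete-≼⇒≡ A≼B)))
               , (λ k l _ _ k≢l A≼ₛB → k≢l (sym (subcomplete-≼⇒≡ (≼ₛ⇒≼ {Subcomplete k} {Subcomplete l} A≼ₛB))))
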